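{- Let $G$ be a graph with a proper colouring using $k$ colours, with colour classes $V_1,\ldots,V_k$, $|V_j|=a_j$, such that $G$ has no proper colouring with $k-1$ colours, and suppose $a_1\geq a_2\geq\cdots\geq a_i>a_{i+1}=a_{i+2}=\cdots=a_k=1$ for some $i$. If $e(V_s,V_t)=1$ for some $s\leq i<t$, then the unique vertex of $V_t$ and its unique neighbour in $V_s$ are each adjacent to all vertices of $V_j$ for every $j>i$ (other than themselves).
   Context: For disjoint sets of vertices $X,Y$ of a graph, $e(X,Y)$ denotes the number of edges between $X$ and $Y$. -}

module Defs where

open import Data.Nat using (ℕ; _∸_)
open import Data.Bool using (Bool; true; false)
import Data.Bool as B
open import Data.Fin using (Fin)
open import Data.Fin.Properties using (_≟_)
open import Data.List using (List; length; filter; allFin; map)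
open import Data.Nat.ListAction using (sum)
open import Data.Product using (∃; _×_)
open import Relation.Nullary.Decidable using (_×-dec_)
open import Relation.Binary.PropositionalEquality using (_≡_; _≢_)

record Graph (n : ℕ) : Set where
  field
    adj    : Fin n → Fin n → Bool
    sym    : ∀ x y → adj x y ≡ adj y x
    irrefl : ∀ x → adj x x ≡ false
open Graph public

Proper : ∀ {n} → Graph n → (k : ℕ) → (Fin n → Fin k) → Set
Proper {n} G k c = ∀ (x y : Fin n) → adj G x y ≡ true → c x ≢ c y

Colourable : ∀ {n} → Graph n → ℕ → Set
Colourable {n} G k = ∃ λ (c : Fin n → Fin k) → Proper G k c

classSize : ∀ {n k} → (Fin n → Fin k) → Fin k → ℕ
classSize {n} c j = length (filter (λ x → c x ≟ j) (allFin n))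

-- e(V_s, V_t): number of pairs (x,y) with x ∈ V_s, y ∈ V_t, x ~ y.
-- (For s ≠ t the classes are disjoint, so this is the number of edges between them.)
eClasses : ∀ {n k} → Graph n → (Fin n → Fin k) → Fin k → Fin k → ℕ
eClasses {n} G c s t =
  sum (map (λ x → length (filter (λ y → ((c x ≟ s) ×-dec (c y ≟ t)) ×-dec (adj G x y B.≟ true))
                                  (allFin n)))
           (allFin n))

{-# OPTIONS --safe #-}
-- A colour class
-- can never be emptied by recolouring vertices properly, since then punching the unused
-- colour out leaves a (k-1)-colouring. If v and w form singleton classes and v ≁ w, then v
-- could move into w's class, emptying its own. If moreover u is the only neighbour of v in
-- u's class and u ≁ w, then u can move into w's class and v into u's old class, which
-- again empties the class of v.
module Submission where

open import Defs renaming (sym to adj-sym)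
open import Data.Nat using (ℕ; _≤_; _<_; _∸_; suc; zero; s≤s)
open import Data.Nat.Properties using (≤-trans; ≤-reflexive; <⇒≱; m≤m+n; m≤n+m; m+n≤o⇒n≤o; +-mono-≤)
open import Data.Nat.ListAction using (sum)
open import Data.Bool using (true; false)
import Data.Bool as B
open import Data.Bool.Properties using (¬-not; not-¬)
open import Data.Fin using (Fin; toℕ; punchOut)
open import Data.Fin.Properties using (_≟_; punchOut-injective)
open import Data.Vec.Functional using (updateAt)
open import Data.Vec.Functional.Properties using (updateAt-updates; updateAt-minimal)
open import Data.List using (List; []; _∷_; length; filter; map; allFin)
open import Data.List.Relation.Unary.Any using (here; there)
open import Data.List.Membership.Propositional using (_∈_)
open import Data.List.Membership.Propositional.Properties using (∈-allFin; ∈-filter⁺; ∈-length; ∈-map⁺)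
open import Data.Product using (_×_; _,_)
open import Function using (_∘_; const)
open import Relation.Nullary using (¬_; yes; no; contradiction; _×-dec_)
open import Relation.Binary.PropositionalEquality using (_≡_; _≢_; refl; sym; trans; subst)

∈⇒≤sum : ∀ {m ns} → m ∈ ns → m ≤ sum ns
∈⇒≤sum {ns = n ∷ ns} (here refl)  = m≤m+n n (sum ns)
∈⇒≤sum {ns = n ∷ ns} (there m∈ns) = ≤-trans (∈⇒≤sum m∈ns) (m≤n+m (sum ns) n)

module _ {A : Set} where

  length≤1⇒members-equal : ∀ {xs : List A} {x y} → length xs ≤ 1 → x ∈ xs → y ∈ xs → x ≡ y
  length≤1⇒members-equal {_ ∷ []}    _          (here refl) (here refl) = refl
  length≤1⇒members-equal {_ ∷ _ ∷ _} (s≤s ())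

  1<sum-map-head∷tail : ∀ {f : A → ℕ} {x y xs} → 0 < f x → y ∈ xs → 0 < f y →
    1 < sum (map f (x ∷ xs))
  1<sum-map-head∷tail {f} fx>0 y∈xs fy>0 = +-mono-≤ fx>0 (≤-trans fy>0 (∈⇒≤sum (∈-map⁺ f y∈xs)))

  sum-map≤1⇒positive-members-equal : ∀ {f : A → ℕ} {xs x y} → sum (map f xs) ≤ 1 →
    x ∈ xs → y ∈ xs → 0 < f x → 0 < f y → x ≡ y
  sum-map≤1⇒positive-members-equal _     (here refl)  (here refl)  _    _    = refl
  sum-map≤1⇒positive-members-equal bound (here refl)  (there y∈xs) fx>0 fy>0 =
    contradiction bound (<⇒≱ (1<sum-map-head∷tail fx>0 y∈xs fy>0))
  sum-map≤1⇒positive-members-equal bound (there x∈xs) (here refl)  fx>0 fy>0 =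
    contradiction bound (<⇒≱ (1<sum-map-head∷tail fy>0 x∈xs fx>0))
  sum-map≤1⇒positive-members-equal {f} {z ∷ _} bound (there x∈xs) (there y∈xs) fx>0 fy>0 =
    sum-map≤1⇒positive-members-equal (m+n≤o⇒n≤o (f z) bound) x∈xs y∈xs fx>0 fy>0

recolour : ∀ {n k} → (Fin n → Fin k) → Fin n → Fin k → Fin n → Fin k
recolour c x col = updateAt c x (const col)

recolour-fibre : ∀ {n k} {c : Fin n → Fin k} {x y col d} → col ≢ d →
  recolour c x col y ≡ d → y ≢ x × c y ≡ d
recolour-fibre {c = c} {x} {y} col≢d eq with y ≟ x
... | yes refl = contradiction (trans (sym (updateAt-updates x c)) eq) col≢d
... | no y≢x   = y≢x , trans (sym (updateAt-minimal y x c y≢x)) eq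

AloneInClass : ∀ {n k} → (Fin n → Fin k) → Fin n → Set
AloneInClass c v = ∀ y → c y ≡ c v → y ≡ v

classSize≡1⇒alone : ∀ {n k} (c : Fin n → Fin k) {j v} → classSize c j ≡ 1 → c v ≡ j →
  AloneInClass c v
classSize≡1⇒alone c {v = v} size≡1 refl y cy≡cv =
  length≤1⇒members-equal (≤-reflexive size≡1)
    (∈-filter⁺ _ (∈-allFin y) cy≡cv)
    (∈-filter⁺ _ (∈-allFin v) refl)

module _ {n} (G : Graph n) where

  SoleNeighbourInClass : ∀ {k} → (Fin n → Fin k) → Fin n → Fin n → Set
  SoleNeighbourInClass c u v = ∀ y → c y ≡ c u → adj G y v ≡ true → y ≡ u

  eClasses≡1⇒sole-neighbour : ∀ {k} (c : Fin n → Fin k) {s t u v} →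
    eClasses G c s t ≡ 1 → c u ≡ s → c v ≡ t → adj G u v ≡ true → SoleNeighbourInClass c u v
  eClasses≡1⇒sole-neighbour c {s} {t} {u} {v} e≡1 refl refl u~v y cy≡cu y~v =
    sum-map≤1⇒positive-members-equal (≤-reflexive e≡1) (∈-allFin y) (∈-allFin u)
      (edges-to-v y cy≡cu y~v) (edges-to-v u refl u~v)
    where
    edgesFrom : Fin n → ℕ
    edgesFrom x = length (filter (λ y → ((c x ≟ s) ×-dec (c y ≟ t)) ×-dec (adj G x y B.≟ true))
                                 (allFin n))
    edges-to-v : ∀ x → c x ≡ s → adj G x v ≡ true → 0 < edgesFrom x
    edges-to-v x cx≡s x~v = ∈-length (∈-filter⁺ _ (∈-allFin v) ((cx≡s , refl) , x~v))

  recolour-proper : ∀ {k} {c : Fin n → Fin k} {x col} → Proper G k c →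
    (∀ y → adj G x y ≡ true → c y ≢ col) → Proper G k (recolour c x col)
  recolour-proper {c = c} {x} proper col-free y z y~z eq with y ≟ x | z ≟ x
  ... | yes refl | yes refl = contradiction (trans (sym y~z) (irrefl G x)) λ ()
  ... | yes refl | no z≢x   = col-free z y~z
    (trans (sym (updateAt-minimal z x c z≢x)) (trans (sym eq) (updateAt-updates x c)))
  ... | no y≢x   | yes refl = col-free y (trans (adj-sym G z y) y~z)
    (trans (sym (updateAt-minimal y x c y≢x)) (trans eq (updateAt-updates x c)))
  ... | no y≢x   | no z≢x   = proper y z y~z
    (trans (sym (updateAt-minimal y x c y≢x)) (trans eq (updateAt-minimal z x c z≢x)))

  unused-colour⇒Colourable : ∀ {k} {c : Fin n → Fin (suc k)} {t} → Proper G (suc k) c →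
    (∀ x → c x ≢ t) → Colourable G k
  unused-colour⇒Colourable proper unused =
    (λ x → punchOut (unused x ∘ sym)) ,
    λ x y x~y eq → proper x y x~y (punchOut-injective (unused x ∘ sym) (unused y ∘ sym) eq)

  module _ {k} {c : Fin n → Fin (suc k)} (proper : Proper G (suc k) c)
           (uncolourable : ¬ Colourable G k) where

    nonadjacent-alone⇒colour-free : ∀ {v w} → AloneInClass c w → adj G v w ≡ false →
      ∀ y → adj G v y ≡ true → c y ≢ c w
    nonadjacent-alone⇒colour-free {v} alone-w v≁w y v~y cy≡cw =
      not-¬ v≁w (subst (λ z → adj G v z ≡ true) (alone-w y cy≡cw) v~y)

    alone-alone⇒adjacent : ∀ {v w} → AloneInClass c v → AloneInClass c w → w ≢ v →
      adj G v w ≡ true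
    alone-alone⇒adjacent {v} {w} alone-v alone-w w≢v = ¬-not λ v≁w →
      uncolourable (unused-colour⇒Colourable
        (recolour-proper proper (nonadjacent-alone⇒colour-free alone-w v≁w)) cv-unused)
      where
      cv-unused : ∀ y → recolour c v (c w) y ≢ c v
      cv-unused y eq with recolour-fibre (w≢v ∘ alone-v w) eq
      ... | y≢v , cy≡cv = y≢v (alone-v y cy≡cv)

    sole-neighbour-of-alone⇒adjacent-to-alone : ∀ {u v w} → AloneInClass c v →
      SoleNeighbourInClass c u v → adj G u v ≡ true → AloneInClass c w → w ≢ u →
      adj G u w ≡ true
    sole-neighbour-of-alone⇒adjacent-to-alone {u} {v} {w} alone-v sole u~v alone-w w≢u
      with w ≟ v
    ... | yes refl = u~v
    ... | no w≢v   = ¬-not λ u≁w →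
      uncolourable (unused-colour⇒Colourable
        (recolour-proper (recolour-proper proper (nonadjacent-alone⇒colour-free alone-w u≁w))
                         cu-free)
        cv-unused)
      where
      cu-free : ∀ y → adj G v y ≡ true → recolour c u (c w) y ≢ c u
      cu-free y v~y eq with recolour-fibre (w≢u ∘ sym ∘ alone-w u ∘ sym) eq
      ... | y≢u , cy≡cu = y≢u (sole y cy≡cu (trans (adj-sym G y v) v~y))
      cv-unused : ∀ y → recolour (recolour c u (c w)) v (c u) y ≢ c v
      cv-unused y eq with recolour-fibre (proper u v u~v) eq
      ... | y≢v , eq′ with recolour-fibre {c = c} (w≢v ∘ alone-v w) eq′
      ...   | _ , cy≡cv = y≢v (alone-v y cy≡cv)

lemma8 : ∀ {n k : ℕ} (G : Graph n) (c : Fin n → Fin k) →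
    Proper G k c →
    ¬ Colourable G (k ∸ 1) →
    (i : ℕ) →
    (∀ (j j′ : Fin k) → toℕ j ≤ toℕ j′ → toℕ j′ < i → classSize c j′ ≤ classSize c j) →
    (∀ (j : Fin k) → toℕ j < i → 1 < classSize c j) →
    (∀ (j : Fin k) → i ≤ toℕ j → classSize c j ≡ 1) →
    ∀ (s t : Fin k) → toℕ s < i → i ≤ toℕ t →
    eClasses G c s t ≡ 1 →
    ∀ (v u : Fin n) → c v ≡ t → c u ≡ s → adj G u v ≡ true →
    ∀ (j : Fin k) → i ≤ toℕ j → ∀ (w : Fin n) → c w ≡ j →
    (w ≢ v → adj G v w ≡ true) × (w ≢ u → adj G u w ≡ true)
lemma8 {k = zero} _ _ _ _ _ _ _ _ ()
lemma8 {k = suc _} G c proper uncolourable _ _ _ size≡1 _ t _ i≤t e≡1 v u cv≡t cu≡s u~v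
       j i≤j w cw≡j =
    alone-alone⇒adjacent G proper uncolourable alone-v alone-w
  , sole-neighbour-of-alone⇒adjacent-to-alone G proper uncolourable
      alone-v (eClasses≡1⇒sole-neighbour G c e≡1 cu≡s cv≡t u~v) u~v alone-w
  where
  alone-v : AloneInClass c v
  alone-v = classSize≡1⇒alone c (size≡1 t i≤t) cv≡t
  alone-w : AloneInClass c w
  alone-w = classSize≡1⇒alone c (size≡1 j i≤j) cw≡j
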